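{- Let $m,n\ge 1$ be integers. The map sending a positive integral frieze $F$ on the annulus $A_{m,n}$ to the family $(u_{i,j})_{i,j\in\mathbb Z}$ with $u_{i,j}=F(\gamma_{i,j})$ is a bijection between positive integral friezes on $A_{m,n}$ and positive integral $(m,n)$-periodic $SL_2$-tilings.
   Context: $A_{m,n}$ is an annulus with $m$ marked points $P_1,\dots,P_m$ on one boundary component and $n$ marked points $Q_1,\dots,Q_n$ on the other. An arc is a non-contractible simple curve in the annulus with endpoints at marked points, considered up to isotopy; the boundary segments between consecutive marked points on a boundary component are also arcs. An arc is bridging if its endpoints lie on different boundary components, peripheral otherwise. A triangulation is a maximal collection of pairwise non-crossing arcs; it cuts the annulus into triangles. A quadrilateral $ABCD$ is a collection of pairwise non-crossing arcs $AB,BC,CD,DA$ cutting out a disc with vertices $A,B,C,D$ in this cyclic order; $AC$ and $BD$ are its diagonals. A positive integral frieze on $A_{m,n}$ is an assignment $F$ of a positive integer to every arc such that $F(\delta)=1$ for every boundary segment $\delta$ and $F(AC)F(BD)=F(AB)F(CD)+F(BC)F(AD)$ for every quadrilateral $ABCD$. The universal cover of $A_{m,n}$ is an infinite strip; the marked points lift to points $\hat P_i$ ($i\in\mathbb Z$) on one boundary line and $\hat Q_j$ ($j\in\mathbb Z$) on the other, with $\hat P_i$ over $P_{i'}$ for $i'\equiv i \pmod m$ and $\hat Q_j$ over $Q_{j'}$ for $j'\equiv j\pmod n$, the generator of the deck group sending $\hat P_i\mapsto \hat P_{i+m}$, $\hat Q_j\mapsto\hat Q_{j+n}$, and the labelling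 chosen so that for all $i,j$ the points $\hat P_i,\hat P_{i+1},\hat Q_{j+1},\hat Q_j$ are vertices of a quadrilateral in this cyclic order. For $i,j\in\mathbb Z$, $\gamma_{i,j}$ denotes the bridging arc of $A_{m,n}$ which is the image of the segment $\hat P_i\hat Q_j$. An $SL_2$-tiling is a family $(u_{i,j})_{i,j\in\mathbb Z}$ of real numbers with $u_{i+1,j}u_{i,j+1}-u_{i,j}u_{i+1,j+1}=1$ for all $i,j$ (all adjacent $2\times2$ minors equal $1$ when row index $i$ increases from bottom to top and column index $j$ from left to right). It is positive integral if all $u_{i,j}$ are positive integers, and $(m,n)$-periodic if $u_{i+m,j+n}=u_{i,j}$ for all $i,j$. -}

module Defs where

open import Data.Nat using (ℕ; suc)
open import Data.Fin using (Fin; toℕ)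
import Data.Fin as Fin
open import Data.Integer as ℤ using (ℤ; +_; 0ℤ; 1ℤ; _<_)
open import Data.Product using (_×_; _,_; Σ; ∃; ∃-syntax)
open import Data.Sum using (_⊎_)
open import Data.Empty using (⊥)
open import Data.Unit using (⊤)
open import Relation.Nullary using (¬_)
open import Relation.Binary.PropositionalEquality using (_≡_)

-- Universal cover of the annulus A_{m,n}: an infinite strip.
-- Lifted marked points: p i = \hat P_i (one boundary line),
--                       q j = \hat Q_j (other boundary line).
-- Convention: \hat P_i, \hat P_{i+1}, \hat Q_{j+1}, \hat Q_j are in
-- (counterclockwise) cyclic order, so walking along the boundary of the
-- strip we meet the P-line with increasing i and then the Q-line with
-- decreasing j.

data Pt : Set where
  p : ℤ → Pt
  q : ℤ → Pt

-- Linear order on the boundary of the strip obtained by cutting its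
-- cyclic boundary order at the left end: P-line left to right, then
-- Q-line right to left.
_≺_ : Pt → Pt → Set
p i ≺ p k = i < k
p i ≺ q j = ⊤
q j ≺ p i = ⊥
q j ≺ q l = l < j

-- Lifts of arcs of A_{m,n} to the strip (segments between lifted points).
--   br i j : the segment \hat P_i \hat Q_j (bridging)
--   pp i d : the segment \hat P_i \hat P_{i+1+d}, 0 ≤ d < m (peripheral;
--            length 1+d ≤ m exactly says its image in A_{m,n} is simple
--            and non-contractible; d = 0 is a boundary segment)
--   qq j d : the segment \hat Q_j \hat Q_{j+1+d}, 0 ≤ d < n
-- Every arc of A_{m,n} is the image of such a segment, and two segments
-- have the same image iff they differ by a deck transformation (shift).

data LArc (m n : ℕ) : Set where
  br : ℤ → ℤ → LArc m n
  pp : ℤ → Fin m → LArc m n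
  qq : ℤ → Fin n → LArc m n

len : ∀ {k} → Fin k → ℤ
len d = + suc (toℕ d)

ends : ∀ {m n} → LArc m n → Pt × Pt
ends (br i j) = p i , q j
ends (pp i d) = p i , p (i ℤ.+ len d)
ends (qq j d) = q (j ℤ.+ len d) , q j

shift : ∀ {m n} → ℤ → LArc m n → LArc m n
shift {m} {n} k (br i j) = br (i ℤ.+ k ℤ.* + m) (j ℤ.+ k ℤ.* + n)
shift {m} {n} k (pp i d) = pp (i ℤ.+ k ℤ.* + m) d
shift {m} {n} k (qq j d) = qq (j ℤ.+ k ℤ.* + n) d

γ : ∀ {m n} → ℤ → ℤ → LArc m n
γ i j = br i j

IsBoundary : ∀ {m n} → LArc m n → Set
IsBoundary (br i j) = ⊥
IsBoundary (pp i d) = toℕ d ≡ 0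
IsBoundary (qq j d) = toℕ d ≡ 0

LCross : Pt × Pt → Pt × Pt → Set
LCross (s , t) (s' , t') =
  (s ≺ s' × s' ≺ t × t ≺ t') ⊎ (s' ≺ s × s ≺ t' × t' ≺ t)

Cross : ∀ {m n} → LArc m n → LArc m n → Set
Cross a b = ∃[ k ] LCross (ends a) (ends (shift k b))

Joins : ∀ {m n} → LArc m n → Pt → Pt → Set
Joins a x y = (ends a ≡ (x , y)) ⊎ (ends a ≡ (y , x))

CycOrder : Pt → Pt → Pt → Pt → Set
CycOrder x y z w =
    (x ≺ y × y ≺ z × z ≺ w) ⊎ (y ≺ z × z ≺ w × w ≺ x)
  ⊎ (z ≺ w × w ≺ x × x ≺ y) ⊎ (w ≺ x × x ≺ y × y ≺ z)

-- A quadrilateral ABCD of A_{m,n}, given through a lift \hat A \hat B \hat C \hat D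
-- in the strip: sides ab, bc, cd, da are (lifts of) arcs joining consecutive
-- vertices, the vertices are in cyclic order, and the four side arcs are
-- pairwise non-crossing in A_{m,n}.
record Quadrilateral {m n : ℕ} (A B C D : Pt) (ab bc cd da : LArc m n) : Set where
  field
    cyc   : CycOrder A B C D
    j-ab  : Joins ab A B
    j-bc  : Joins bc B C
    j-cd  : Joins cd C D
    j-da  : Joins da D A
    nc-ab-bc : ¬ Cross ab bc
    nc-ab-cd : ¬ Cross ab cd
    nc-ab-da : ¬ Cross ab da
    nc-bc-cd : ¬ Cross bc cd
    nc-bc-da : ¬ Cross bc da
    nc-cd-da : ¬ Cross cd da

-- Positive integral friezes on A_{m,n}: a function on arcs of A_{m,n},
-- represented as a function on lifts that is invariant under the deck group.

record IsPosIntFrieze (m n : ℕ) (F : LArc m n → ℤ) : Set where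
  field
    invariant : ∀ k a → F (shift k a) ≡ F a
    positive  : ∀ a → 0ℤ < F a
    boundary  : ∀ a → IsBoundary a → F a ≡ 1ℤ
    ptolemy   : ∀ A B C D (ab bc cd da ac bd : LArc m n) →
                Quadrilateral A B C D ab bc cd da →
                Joins ac A C → Joins bd B D →
                F ac ℤ.* F bd ≡ F ab ℤ.* F cd ℤ.+ F bc ℤ.* F da

record IsPosIntPeriodicSL2Tiling (m n : ℕ) (u : ℤ → ℤ → ℤ) : Set where
  field
    positive : ∀ i j → 0ℤ < u i j
    sl2      : ∀ i j → u (i ℤ.+ 1ℤ) j ℤ.* u i (j ℤ.+ 1ℤ)
                         ℤ.- u i j ℤ.* u (i ℤ.+ 1ℤ) (j ℤ.+ 1ℤ) ≡ 1ℤ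
    periodic : ∀ i j → u (i ℤ.+ + m) (j ℤ.+ + n) ≡ u i j

Φ : ∀ {m n} → (LArc m n → ℤ) → ℤ → ℤ → ℤ
Φ F i j = F (γ i j)

-- A frieze F restricts on bridging arcs to an SL₂-tiling: the Ptolemy relation on the quadrilateral
-- P_i P_{i+1} Q_{j+1} Q_j, two of whose sides are boundary segments, is the unimodularity of the
-- adjacent 2×2 minor at (i, j). The bridging values determine F: Ptolemy on the fan
-- P_i P_{i+1} P_{i+1+l} Q_j (and its mirror image on the Q side) expresses a peripheral arc through a
-- shorter one and bridging arcs. The sides of these quadrilaterals do not cross because no deck
-- translate of an endpoint of one side falls strictly inside the interval spanned by another.
--
-- Conversely, in a positive SL₂-tiling the rows satisfy one common three-term recurrence
-- u k j + u k (j+2) = c_j · u k (j+1), hence u i j = det (x i) (w j) for vectors x i, w j ∈ ℤ² with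
-- det (x i) (x (i+1)) = det (w (j+1)) (w j) = 1. Sending an arc to the determinant of the vectors of
-- its endpoints, in their order along the boundary of the strip, gives a frieze: the Ptolemy relation
-- is the Plücker relation, positivity follows inductively from Plücker, and invariance under the
-- deck group from the periodicity of u.
module Submission where

open import Defs
open import Data.Nat as ℕ using (ℕ; zero; suc; z≤n; s≤s)
import Data.Nat.Properties as ℕₚ
open import Data.Fin using (Fin; toℕ; inject₁) renaming (zero to fzero; suc to fsuc)
open import Data.Fin.Properties using (toℕ-inject₁; toℕ<n)
open import Data.Fin.Induction using (<-weakInduction)
open import Data.Integer as ℤ
  using ( ℤ; +_; -[1+_]; 0ℤ; 1ℤ; -1ℤ; _+_; _-_; -_; _*_; _≤_; _<_; +≤+; -≤-; -≤+; +<+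
        ; >-nonZero; nonNegative)
open import Data.Integer.Properties
open import Data.Integer.Tactic.RingSolver using (solve-∀)
open import Data.Product as Product using (_×_; _,_; proj₁; proj₂; Σ; ∃-syntax)
open import Data.Sum as Sum using (_⊎_; inj₁; inj₂; swap)
open import Data.Unit using (tt)
open import Data.Empty using (⊥; ⊥-elim)
open import Function using (_∘_)
open import Relation.Nullary using (¬_)
open import Relation.Binary.PropositionalEquality
import Algebra.Properties.CommutativeSemigroup +-commutativeSemigroup as +-Semigroup
import Algebra.Properties.CommutativeSemigroup *-commutativeSemigroup as *-Semigroup
open import Algebra.Properties.AbelianGroup +-0-abelianGroup using (∙-cancelˡ; ∙-cancelʳ; //-rightDividesʳ)

ℤ-induction : (P : ℤ → Set) → P 0ℤ → (∀ k → P k → P (k + 1ℤ)) → (∀ k → P (k + 1ℤ) → P k) →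
              ∀ k → P k
ℤ-induction P P₀ up down (+ n) = nonNeg n
  where
  nonNeg : ∀ n → P (+ n)
  nonNeg zero    = P₀
  nonNeg (suc n) = subst P (cong +_ (ℕₚ.+-comm n 1)) (up (+ n) (nonNeg n))
ℤ-induction P P₀ up down -[1+ n ] = neg n
  where
  neg : ∀ n → P -[1+ n ]
  neg zero    = down -1ℤ P₀
  neg (suc n) = down -[1+ suc n ] (neg n)

i<i+len : ∀ {k} i (d : Fin k) → i < i + len d
i<i+len i d = subst (_< i + len d) (+-identityʳ i) (+-monoʳ-< i (+<+ (s≤s z≤n)))

i<i+1 : ∀ i → i < i + 1ℤ
i<i+1 i = i<i+len {1} i fzero

i+[1+t]+1≡i+[2+t] : ∀ i t → i + + suc t + 1ℤ ≡ i + + suc (suc t)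
i+[1+t]+1≡i+[2+t] i t = trans (+-assoc i (+ suc t) 1ℤ) (cong (λ s → i + + suc s) (ℕₚ.+-comm t 1))

no-integer-between : ∀ i x → i < x → x < i + 1ℤ → ⊥
no-integer-between i x i<x x<i+1 = <⇒≱ x<i+1 (≤-trans (≤-reflexive (+-comm i 1ℤ)) (i<j⇒suc[i]≤j i<x))

≤0⊎≥1 : ∀ k → k ≤ 0ℤ ⊎ 1ℤ ≤ k
≤0⊎≥1 (+ zero)  = inj₁ ≤-refl
≤0⊎≥1 (+ suc _) = inj₂ (+≤+ (s≤s z≤n))
≤0⊎≥1 -[1+ _ ]  = inj₁ -≤+

cancel-pos-factor : ∀ {x x′ y y′} → 0ℤ < y′ → y ≡ y′ → x * y ≡ x′ * y′ → x ≡ x′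
cancel-pos-factor {x} {x′} {y′ = y′} y′>0 refl = *-cancelʳ-≡ x x′ y′ {{>-nonZero y′>0}}

translate-back : ∀ i k M → (i + k * M) + (- k) * M ≡ i
translate-back = solve-∀

module _ (K : ℕ) where

  translate-mono : ∀ c k l → k ≤ l → c + k * + K ≤ c + l * + K
  translate-mono c k l k≤l = +-monoʳ-≤ c (*-monoʳ-≤-nonNeg (+ K) k≤l)

  translate-nonPos : ∀ c k → k ≤ 0ℤ → c + k * + K ≤ c
  translate-nonPos c k k≤0 = ≤-trans (translate-mono c k 0ℤ k≤0) (≤-reflexive (+-identityʳ c))

  translate-nonNeg : ∀ c k → 0ℤ ≤ k → c ≤ c + k * + K
  translate-nonNeg c k 0≤k = ≤-trans (≤-reflexive (sym (+-identityʳ c))) (translate-mono c 0ℤ k 0≤k)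

  translate-pos : ∀ c k → 1ℤ ≤ k → c + + K ≤ c + k * + K
  translate-pos c k 1≤k =
    ≤-trans (≤-reflexive (cong (_+_ c) (sym (*-identityˡ (+ K))))) (translate-mono c 1ℤ k 1≤k)

  translate-neg : ∀ c k → k ≤ -1ℤ → c + k * + K ≤ c - + K
  translate-neg c k k≤-1 =
    ≤-trans (translate-mono c k -1ℤ k≤-1) (≤-reflexive (cong (_+_ c) (-1*i≡-i (+ K))))

  pred-translates-avoid : ∀ {a L} k → 1ℤ + L ≤ + K →
                          a + 1ℤ < a + k * + K → a + k * + K < (a + 1ℤ) + L → ⊥
  pred-translates-avoid {a} (+ zero) _ lo _ =
    <⇒≱ lo (≤-trans (translate-nonPos a (+ zero) ≤-refl) (<⇒≤ (i<i+1 a)))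
  pred-translates-avoid {a} -[1+ r ] _ lo _ =
    <⇒≱ lo (≤-trans (translate-nonPos a -[1+ r ] -≤+) (<⇒≤ (i<i+1 a)))
  pred-translates-avoid {a} {L} (+ suc r) 1+L≤K _ hi = <⇒≱ hi (begin
    (a + 1ℤ) + L       ≡⟨ +-assoc a 1ℤ L ⟩
    a + (1ℤ + L)       ≤⟨ +-monoʳ-≤ a 1+L≤K ⟩
    a + + K            ≤⟨ translate-pos a (+ suc r) (+≤+ (s≤s z≤n)) ⟩
    a + + suc r * + K  ∎)
    where open ≤-Reasoning

  end-translates-avoid : ∀ {a L} k → L ≤ + K →
                         a < (a + L) + k * + K → (a + L) + k * + K < a + L → ⊥
  end-translates-avoid {a} {L} (+ r) _ _ hi = <⇒≱ hi (translate-nonNeg (a + L) (+ r) (+≤+ z≤n))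
  end-translates-avoid {a} {L} -[1+ r ] L≤K lo _ = <⇒≱ lo (begin
    (a + L) + -[1+ r ] * + K  ≤⟨ translate-neg (a + L) -[1+ r ] (-≤- z≤n) ⟩
    (a + L) - + K             ≤⟨ +-monoˡ-≤ (- + K) (+-monoʳ-≤ a L≤K) ⟩
    (a + + K) - + K           ≡⟨ //-rightDividesʳ (+ K) a ⟩
    a                         ∎)
    where open ≤-Reasoning

-- Crossings in the universal cover

≺-trans : ∀ {x y z} → x ≺ y → y ≺ z → x ≺ z
≺-trans {p _} {p _} {p _} x<y y<z = <-trans x<y y<z
≺-trans {p _} {p _} {q _} _   _   = tt
≺-trans {p _} {q _} {q _} _   _   = tt
≺-trans {q _} {q _} {q _} y<x z<y = <-trans z<y y<x
≺-trans {p _} {q _} {p _} _   ()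
≺-trans {q _} {p _} ()
≺-trans {q _} {q _} {p _} _   ()

≺-asym : ∀ {x y} → x ≺ y → y ≺ x → ⊥
≺-asym {p _} {p _} = <-asym
≺-asym {q _} {q _} = <-asym
≺-asym {p _} {q _} _ ()
≺-asym {q _} {p _} ()

module _ {m n : ℕ} where

  ends-ordered : (a : LArc m n) → proj₁ (ends a) ≺ proj₂ (ends a)
  ends-ordered (br i j) = tt
  ends-ordered (pp i d) = i<i+len i d
  ends-ordered (qq j d) = i<i+len j d

  boundary-gap : (a : LArc m n) {z : Pt} → IsBoundary a →
                 proj₁ (ends a) ≺ z → z ≺ proj₂ (ends a) → ⊥
  boundary-gap (pp i fzero) {p x} _ i<x x<i+1 = no-integer-between i x i<x x<i+1
  boundary-gap (qq j fzero) {q x} _ x<j+1 j<x = no-integer-between j x j<x x<j+1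
  boundary-gap (pp i fzero) {q x} _ _ ()
  boundary-gap (qq j fzero) {p x} _ ()

  shiftPt : ℤ → Pt → Pt
  shiftPt k (p i) = p (i + k * + m)
  shiftPt k (q j) = q (j + k * + n)

  shiftPt-mono : ∀ k {x y} → x ≺ y → shiftPt k x ≺ shiftPt k y
  shiftPt-mono k {p _} {p _} = +-monoˡ-< (k * + m)
  shiftPt-mono k {q _} {q _} = +-monoˡ-< (k * + n)
  shiftPt-mono k {p _} {q _} _ = tt
  shiftPt-mono k {q _} {p _} ()

  ends-shift : ∀ k (a : LArc m n) → ends (shift k a) ≡ Product.map (shiftPt k) (shiftPt k) (ends a)
  ends-shift k (br i j) = refl
  ends-shift k (pp i d) = cong (λ x → p (i + k * + m) , p x) (+-Semigroup.xy∙z≈xz∙y i (k * + m) (len d))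
  ends-shift k (qq j d) = cong (λ x → q x , q (j + k * + n)) (+-Semigroup.xy∙z≈xz∙y j (k * + n) (len d))

  shift-inverse : ∀ k (a : LArc m n) → shift (- k) (shift k a) ≡ a
  shift-inverse k (br i j) = cong₂ br (translate-back i k (+ m)) (translate-back j k (+ n))
  shift-inverse k (pp i d) = cong (λ x → pp x d) (translate-back i k (+ m))
  shift-inverse k (qq j d) = cong (λ x → qq x d) (translate-back j k (+ n))

  LCross-shift : ∀ k {x y} → LCross x y →
                 LCross (Product.map (shiftPt k) (shiftPt k) x) (Product.map (shiftPt k) (shiftPt k) y)
  LCross-shift k = Sum.map mono₃ mono₃
    where
    mono₃ : ∀ {x y z w} → x ≺ y × y ≺ z × z ≺ w →
            shiftPt k x ≺ shiftPt k y × shiftPt k y ≺ shiftPt k z × shiftPt k z ≺ shiftPt k w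
    mono₃ (x≺y , y≺z , z≺w) = shiftPt-mono k x≺y , shiftPt-mono k y≺z , shiftPt-mono k z≺w

  Cross-sym : {a b : LArc m n} → Cross a b → Cross b a
  Cross-sym {a} {b} (k , a×kb) =
    - k , swap (subst₂ LCross (sym (ends-shift (- k) a)) shifted-back (LCross-shift (- k) a×kb))
    where
    shifted-back : Product.map (shiftPt (- k)) (shiftPt (- k)) (ends (shift k b)) ≡ ends b
    shifted-back = trans (sym (ends-shift (- k) (shift k b))) (cong ends (shift-inverse k b))

  boundary-uncrossed : (a b : LArc m n) → IsBoundary a → ¬ Cross a b
  boundary-uncrossed a _ bd (_ , inj₁ (s≺s′ , s′≺t , _)) = boundary-gap a bd s≺s′ s′≺t
  boundary-uncrossed a _ bd (_ , inj₂ (_ , s≺t′ , t′≺t)) = boundary-gap a bd s≺t′ t′≺t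

  boundary-uncrossedʳ : (a b : LArc m n) → IsBoundary b → ¬ Cross a b
  boundary-uncrossedʳ a b bd = boundary-uncrossed b a bd ∘ Cross-sym {a = a} {b = b}

  pp-br-crossing : ∀ a c j (d : Fin m) → Cross {m} {n} (pp a d) (br c j) →
                   ∃[ k ] (a < c + k * + m × c + k * + m < a + len d)
  pp-br-crossing _ _ _ _ (k , inj₁ (lo , hi , _)) = k , lo , hi
  pp-br-crossing _ _ _ _ (k , inj₂ (_ , _ , ()))

  qq-br-crossing : ∀ b i c (d : Fin n) → Cross {m} {n} (qq b d) (br i c) →
                   ∃[ k ] (b < c + k * + n × c + k * + n < b + len d)
  qq-br-crossing _ _ _ _ (k , inj₁ (() , _ , _))
  qq-br-crossing _ _ _ _ (k , inj₂ (_ , hi , lo)) = k , lo , hi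

  pp-end-uncrossed : ∀ a j (d : Fin m) → len d ≤ + m → ¬ Cross {m} {n} (pp a d) (br (a + len d) j)
  pp-end-uncrossed a j d L≤m crossing =
    let k , lo , hi = pp-br-crossing a (a + len d) j d crossing
    in  end-translates-avoid m {a} {len d} k L≤m lo hi

  pp-pred-uncrossed : ∀ c j (d : Fin m) → 1ℤ + len d ≤ + m → ¬ Cross {m} {n} (pp (c + 1ℤ) d) (br c j)
  pp-pred-uncrossed c j d 1+L≤m crossing =
    let k , lo , hi = pp-br-crossing (c + 1ℤ) c j d crossing
    in  pred-translates-avoid m {c} {len d} k 1+L≤m lo hi

  qq-end-uncrossed : ∀ b i (d : Fin n) → len d ≤ + n → ¬ Cross {m} {n} (qq b d) (br i (b + len d))
  qq-end-uncrossed b i d L≤n crossing =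
    let k , lo , hi = qq-br-crossing b i (b + len d) d crossing
    in  end-translates-avoid n {b} {len d} k L≤n lo hi

  qq-pred-uncrossed : ∀ c i (d : Fin n) → 1ℤ + len d ≤ + n → ¬ Cross {m} {n} (qq (c + 1ℤ) d) (br i c)
  qq-pred-uncrossed c i d 1+L≤n crossing =
    let k , lo , hi = qq-br-crossing (c + 1ℤ) i c d crossing
    in  pred-translates-avoid n {c} {len d} k 1+L≤n lo hi

  br-br-uncrossed : ∀ {i i′ j j′} → i ≤ i′ → i′ ≤ i + + m → j ≤ j′ → j′ ≤ j + + n →
                    ¬ Cross {m} {n} (br i′ j′) (br i j)
  br-br-uncrossed {i} {i′} {j} {j′} i≤i′ i′≤i+m j≤j′ j′≤j+n (k , crossing) with ≤0⊎≥1 k | crossing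
  ... | inj₁ k≤0 | inj₁ (i′<i+km , _ , _) = <⇒≱ i′<i+km (≤-trans (translate-nonPos m i k k≤0) i≤i′)
  ... | inj₂ k≥1 | inj₁ (_ , _ , j+kn<j′) = <⇒≱ j+kn<j′ (≤-trans j′≤j+n (translate-pos n j k k≥1))
  ... | inj₁ k≤0 | inj₂ (_ , _ , j′<j+kn) = <⇒≱ j′<j+kn (≤-trans (translate-nonPos n j k k≤0) j≤j′)
  ... | inj₂ k≥1 | inj₂ (i+km<i′ , _ , _) = <⇒≱ i+km<i′ (≤-trans i′≤i+m (translate-pos m i k k≥1))

c≤c+1+len : ∀ {k} c (d : Fin k) → c ≤ (c + 1ℤ) + len d
c≤c+1+len c d = <⇒≤ (<-trans (i<i+1 c) (i<i+len (c + 1ℤ) d))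

c+1+len≤c+K : ∀ {k K} c (d : Fin k) → 1ℤ + len d ≤ K → (c + 1ℤ) + len d ≤ c + K
c+1+len≤c+K c d 1+L≤K = ≤-trans (≤-reflexive (+-assoc c 1ℤ (len d))) (+-monoʳ-≤ c 1+L≤K)

1+len[inject₁]≤ : ∀ {k} (d : Fin k) → 1ℤ + len (inject₁ d) ≤ + suc k
1+len[inject₁]≤ d = +≤+ (s≤s (subst (ℕ._< _) (sym (toℕ-inject₁ d)) (toℕ<n d)))

len-fsuc : ∀ {k} i (d : Fin k) → i + len (fsuc d) ≡ (i + 1ℤ) + len (inject₁ d)
len-fsuc i d =
  trans (cong (λ t → i + + suc (suc t)) (sym (toℕ-inject₁ d))) (sym (+-assoc i 1ℤ (len (inject₁ d))))

module _ {m n : ℕ} where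

  private
    1≤m : 1ℤ ≤ + suc m
    1≤m = +≤+ (s≤s z≤n)
    1≤n : 1ℤ ≤ + suc n
    1≤n = +≤+ (s≤s z≤n)

  unit-square : ∀ i j → Quadrilateral {suc m} {suc n} (p i) (p (i + 1ℤ)) (q (j + 1ℤ)) (q j)
                          (pp i fzero) (br (i + 1ℤ) (j + 1ℤ)) (qq j fzero) (br i j)
  unit-square i j = record
    { cyc      = inj₁ (i<i+1 i , tt , i<i+1 j)
    ; j-ab     = inj₁ refl
    ; j-bc     = inj₁ refl
    ; j-cd     = inj₁ refl
    ; j-da     = inj₂ refl
    ; nc-ab-bc = boundary-uncrossed ab bc refl
    ; nc-ab-cd = boundary-uncrossed ab cd refl
    ; nc-ab-da = boundary-uncrossed ab da refl
    ; nc-bc-cd = boundary-uncrossedʳ bc cd refl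
    ; nc-bc-da = br-br-uncrossed (<⇒≤ (i<i+1 i)) (+-monoʳ-≤ i 1≤m) (<⇒≤ (i<i+1 j)) (+-monoʳ-≤ j 1≤n)
    ; nc-cd-da = boundary-uncrossed cd da refl
    }
    where
    ab bc cd da : LArc (suc m) (suc n)
    ab = pp i fzero
    bc = br (i + 1ℤ) (j + 1ℤ)
    cd = qq j fzero
    da = br i j

  P-fan : ∀ i j (d : Fin (suc m)) → 1ℤ + len d ≤ + suc m →
          Quadrilateral {suc m} {suc n} (p i) (p (i + 1ℤ)) (p ((i + 1ℤ) + len d)) (q j)
            (pp i fzero) (pp (i + 1ℤ) d) (br ((i + 1ℤ) + len d) j) (br i j)
  P-fan i j d 1+L≤m = record
    { cyc      = inj₁ (i<i+1 i , i<i+len (i + 1ℤ) d , tt)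
    ; j-ab     = inj₁ refl
    ; j-bc     = inj₁ refl
    ; j-cd     = inj₁ refl
    ; j-da     = inj₂ refl
    ; nc-ab-bc = boundary-uncrossed ab bc refl
    ; nc-ab-cd = boundary-uncrossed ab cd refl
    ; nc-ab-da = boundary-uncrossed ab da refl
    ; nc-bc-cd = pp-end-uncrossed {n = suc n} (i + 1ℤ) j d (≤-trans (i≤j+i (len d) 1ℤ) 1+L≤m)
    ; nc-bc-da = pp-pred-uncrossed {n = suc n} i j d 1+L≤m
    ; nc-cd-da = br-br-uncrossed (c≤c+1+len i d) (c+1+len≤c+K i d 1+L≤m) ≤-refl (i≤i+j j (+ suc n))
    }
    where
    ab bc cd da : LArc (suc m) (suc n)
    ab = pp i fzero
    bc = pp (i + 1ℤ) d
    cd = br ((i + 1ℤ) + len d) j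
    da = br i j

  Q-fan : ∀ i j (d : Fin (suc n)) → 1ℤ + len d ≤ + suc n →
          Quadrilateral {suc m} {suc n} (p i) (q ((j + 1ℤ) + len d)) (q (j + 1ℤ)) (q j)
            (br i ((j + 1ℤ) + len d)) (qq (j + 1ℤ) d) (qq j fzero) (br i j)
  Q-fan i j d 1+L≤n = record
    { cyc      = inj₁ (tt , i<i+len (j + 1ℤ) d , i<i+1 j)
    ; j-ab     = inj₁ refl
    ; j-bc     = inj₁ refl
    ; j-cd     = inj₁ refl
    ; j-da     = inj₂ refl
    ; nc-ab-bc = qq-end-uncrossed {m = suc m} (j + 1ℤ) i d (≤-trans (i≤j+i (len d) 1ℤ) 1+L≤n)
                 ∘ Cross-sym {a = ab} {b = bc}
    ; nc-ab-cd = boundary-uncrossedʳ ab cd refl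
    ; nc-ab-da = br-br-uncrossed ≤-refl (i≤i+j i (+ suc m)) (c≤c+1+len j d) (c+1+len≤c+K j d 1+L≤n)
    ; nc-bc-cd = boundary-uncrossedʳ bc cd refl
    ; nc-bc-da = qq-pred-uncrossed {m = suc m} j i d 1+L≤n
    ; nc-cd-da = boundary-uncrossed cd da refl
    }
    where
    ab bc cd da : LArc (suc m) (suc n)
    ab = br i ((j + 1ℤ) + len d)
    bc = qq (j + 1ℤ) d
    cd = qq j fzero
    da = br i j

-- From friezes to tilings

module _ {m n : ℕ} {F : LArc (suc m) (suc n) → ℤ} (isF : IsPosIntFrieze (suc m) (suc n) F) where

  open IsPosIntFrieze isF

  frieze-sl2 : ∀ i j → F (br (i + 1ℤ) j) * F (br i (j + 1ℤ)) - F (br i j) * F (br (i + 1ℤ) (j + 1ℤ)) ≡ 1ℤ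
  frieze-sl2 i j = begin
    F bd * F ac - F da * F bc                ≡⟨ cong₂ _-_ (*-comm (F bd) (F ac)) (*-comm (F da) (F bc)) ⟩
    F ac * F bd - F bc * F da                ≡⟨ cong (_- F bc * F da) square-ptolemy ⟩
    F ab * F cd + F bc * F da - F bc * F da  ≡⟨ cong₂ (λ x y → x * y + F bc * F da - F bc * F da)
                                                      (boundary ab refl) (boundary cd refl) ⟩
    1ℤ + F bc * F da - F bc * F da           ≡⟨ //-rightDividesʳ (F bc * F da) 1ℤ ⟩
    1ℤ                                       ∎
    where
    open ≡-Reasoning
    ab bc cd da ac bd : LArc (suc m) (suc n)
    ab = pp i fzero
    bc = br (i + 1ℤ) (j + 1ℤ)
    cd = qq j fzero
    da = br i j
    ac = br i (j + 1ℤ)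
    bd = br (i + 1ℤ) j
    square-ptolemy : F ac * F bd ≡ F ab * F cd + F bc * F da
    square-ptolemy = ptolemy _ _ _ _ ab bc cd da ac bd (unit-square i j) (inj₁ refl) (inj₁ refl)

  frieze-periodic : ∀ i j → F (br (i + + suc m) (j + + suc n)) ≡ F (br i j)
  frieze-periodic i j =
    trans (cong₂ (λ x y → F (br (i + x) (j + y))) (sym (*-identityˡ _)) (sym (*-identityˡ _)))
          (invariant 1ℤ (br i j))

  frieze⇒tiling : IsPosIntPeriodicSL2Tiling (suc m) (suc n) (Φ F)
  frieze⇒tiling = record
    { positive = λ i j → positive (br i j)
    ; sl2      = frieze-sl2
    ; periodic = frieze-periodic
    }

module _ {m n : ℕ} {F G : LArc (suc m) (suc n) → ℤ}
         (isF : IsPosIntFrieze (suc m) (suc n) F) (isG : IsPosIntFrieze (suc m) (suc n) G) where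

  private
    module F = IsPosIntFrieze isF
    module G = IsPosIntFrieze isG

  boundary-agree : ∀ a → IsBoundary a → F a ≡ G a
  boundary-agree a bd = trans (F.boundary a bd) (sym (G.boundary a bd))

  diagonal-products-agree : ∀ {A B C D} {ab bc cd da} ac bd → Quadrilateral A B C D ab bc cd da →
                            Joins ac A C → Joins bd B D →
                            F ab ≡ G ab → F bc ≡ G bc → F cd ≡ G cd → F da ≡ G da →
                            F ac * F bd ≡ G ac * G bd
  diagonal-products-agree {A} {B} {C} {D} {ab} {bc} {cd} {da} ac bd Q jac jbd eab ebc ecd eda = begin
    F ac * F bd                ≡⟨ F.ptolemy A B C D ab bc cd da ac bd Q jac jbd ⟩
    F ab * F cd + F bc * F da  ≡⟨ cong₂ _+_ (cong₂ _*_ eab ecd) (cong₂ _*_ ebc eda) ⟩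
    G ab * G cd + G bc * G da  ≡⟨ G.ptolemy A B C D ab bc cd da ac bd Q jac jbd ⟨
    G ac * G bd                ∎
    where open ≡-Reasoning

  module _ (bridging : ∀ i j → F (br i j) ≡ G (br i j)) where

    pp-agree : ∀ d i → F (pp i d) ≡ G (pp i d)
    pp-agree = <-weakInduction (λ d → ∀ i → F (pp i d) ≡ G (pp i d))
                               (λ i → boundary-agree (pp i fzero) refl) longer
      where
      longer : ∀ d → (∀ i → F (pp i (inject₁ d)) ≡ G (pp i (inject₁ d))) →
               ∀ i → F (pp i (fsuc d)) ≡ G (pp i (fsuc d))
      longer d shorter i = cancel-pos-factor (G.positive bd) (bridging (i + 1ℤ) 0ℤ)
        (diagonal-products-agree ac bd (P-fan i 0ℤ (inject₁ d) (1+len[inject₁]≤ d))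
          (inj₁ (cong (λ x → p i , p x) (len-fsuc i d))) (inj₁ refl)
          (boundary-agree (pp i fzero) refl) (shorter (i + 1ℤ)) (bridging _ _) (bridging _ _))
        where
        ac bd : LArc (suc m) (suc n)
        ac = pp i (fsuc d)
        bd = br (i + 1ℤ) 0ℤ

    qq-agree : ∀ d j → F (qq j d) ≡ G (qq j d)
    qq-agree = <-weakInduction (λ d → ∀ j → F (qq j d) ≡ G (qq j d))
                               (λ j → boundary-agree (qq j fzero) refl) longer
      where
      longer : ∀ d → (∀ j → F (qq j (inject₁ d)) ≡ G (qq j (inject₁ d))) →
               ∀ j → F (qq j (fsuc d)) ≡ G (qq j (fsuc d))
      longer d shorter j = cancel-pos-factor (G.positive ac) (bridging 0ℤ (j + 1ℤ)) (begin
        F bd * F ac  ≡⟨ *-comm (F bd) (F ac) ⟩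
        F ac * F bd  ≡⟨ diagonal-products-agree ac bd (Q-fan 0ℤ j (inject₁ d) (1+len[inject₁]≤ d))
                          (inj₁ refl) (inj₁ (cong (λ x → q x , q j) (len-fsuc j d)))
                          (bridging _ _) (shorter (j + 1ℤ)) (boundary-agree (qq j fzero) refl)
                          (bridging _ _) ⟩
        G ac * G bd  ≡⟨ *-comm (G ac) (G bd) ⟩
        G bd * G ac  ∎)
        where
        open ≡-Reasoning
        ac bd : LArc (suc m) (suc n)
        ac = br 0ℤ (j + 1ℤ)
        bd = qq j (fsuc d)

    frieze-determined : ∀ a → F a ≡ G a
    frieze-determined (br i j) = bridging i j
    frieze-determined (pp i d) = pp-agree d i
    frieze-determined (qq j d) = qq-agree d j

-- From tilings to friezes

ℤ² : Set
ℤ² = ℤ × ℤ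

det : ℤ² → ℤ² → ℤ
det (a₁ , a₂) (b₁ , b₂) = a₁ * b₂ - a₂ * b₁

det-antisym : ∀ A B → det A B ≡ - det B A
det-antisym (a₁ , a₂) (b₁ , b₂) = antisym a₁ a₂ b₁ b₂
  where
  antisym : ∀ a₁ a₂ b₁ b₂ → a₁ * b₂ - a₂ * b₁ ≡ - (b₁ * a₂ - b₂ * a₁)
  antisym = solve-∀

det-plücker : ∀ A B C D → det A C * det B D ≡ det A B * det C D + det B C * det A D
det-plücker (a₁ , a₂) (b₁ , b₂) (c₁ , c₂) (d₁ , d₂) = plücker a₁ a₂ b₁ b₂ c₁ c₂ d₁ d₂
  where
  plücker : ∀ a₁ a₂ b₁ b₂ c₁ c₂ d₁ d₂ →
            (a₁ * c₂ - a₂ * c₁) * (b₁ * d₂ - b₂ * d₁)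
            ≡ (a₁ * b₂ - a₂ * b₁) * (c₁ * d₂ - c₂ * d₁) + (b₁ * c₂ - b₂ * c₁) * (a₁ * d₂ - a₂ * d₁)
  plücker = solve-∀

det-in-unimodular-basis : ∀ A B C D → det C D ≡ 1ℤ →
                          det A B ≡ det A C * det B D - det A D * det B C
det-in-unimodular-basis A B C D CD≡1 = begin
  det A B
    ≡⟨ *-identityʳ (det A B) ⟨
  det A B * 1ℤ
    ≡⟨ cong (_*_ (det A B)) CD≡1 ⟨
  det A B * det C D
    ≡⟨ //-rightDividesʳ (det B C * det A D) _ ⟨
  det A B * det C D + det B C * det A D - det B C * det A D
    ≡⟨ cong (_- det B C * det A D) (det-plücker A B C D) ⟨
  det A C * det B D - det B C * det A D
    ≡⟨ cong (_-_ (det A C * det B D)) (*-comm (det B C) (det A D)) ⟩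
  det A C * det B D - det A D * det B C
    ∎
  where open ≡-Reasoning

cramer : ℤ² → ℤ² → ℤ → ℤ → ℤ²
cramer (a₀ , b₀) (a₁ , b₁) r₀ r₁ = r₀ * a₁ - r₁ * a₀ , r₀ * b₁ - r₁ * b₀

cramer-det₀ : ∀ w₀ w₁ r₀ r₁ → det w₁ w₀ ≡ 1ℤ → det (cramer w₀ w₁ r₀ r₁) w₀ ≡ r₀
cramer-det₀ (a₀ , b₀) (a₁ , b₁) r₀ r₁ unimodular =
  trans (factor a₀ b₀ a₁ b₁ r₀ r₁) (trans (cong (_*_ r₀) unimodular) (*-identityʳ r₀))
  where
  factor : ∀ a₀ b₀ a₁ b₁ r₀ r₁ →
           (r₀ * a₁ - r₁ * a₀) * b₀ - (r₀ * b₁ - r₁ * b₀) * a₀ ≡ r₀ * (a₁ * b₀ - b₁ * a₀)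
  factor = solve-∀

cramer-det₁ : ∀ w₀ w₁ r₀ r₁ → det w₁ w₀ ≡ 1ℤ → det (cramer w₀ w₁ r₀ r₁) w₁ ≡ r₁
cramer-det₁ (a₀ , b₀) (a₁ , b₁) r₀ r₁ unimodular =
  trans (factor a₀ b₀ a₁ b₁ r₀ r₁) (trans (cong (_*_ r₁) unimodular) (*-identityʳ r₁))
  where
  factor : ∀ a₀ b₀ a₁ b₁ r₀ r₁ →
           (r₀ * a₁ - r₁ * a₀) * b₁ - (r₀ * b₁ - r₁ * b₀) * a₁ ≡ r₁ * (a₁ * b₀ - b₁ * a₀)
  factor = solve-∀

_∥_ : ℤ² → ℤ² → Set
(a₁ , b₁) ∥ (a₂ , b₂) = a₁ * b₂ ≡ b₁ * a₂

∥-refl : ∀ {v} → v ∥ v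
∥-refl {a , b} = *-comm a b

∥-sym : ∀ {v w} → v ∥ w → w ∥ v
∥-sym {a₁ , b₁} {a₂ , b₂} v∥w = trans (*-comm a₂ b₁) (trans (sym v∥w) (*-comm a₁ b₂))

∥-trans : ∀ {u v w} → 0ℤ < proj₂ v → u ∥ v → v ∥ w → u ∥ w
∥-trans {a₁ , b₁} {a₂ , b₂} {a₃ , b₃} b₂>0 u∥v v∥w = cancel-pos-factor b₂>0 refl (begin
  a₁ * b₃ * b₂    ≡⟨ *-Semigroup.xy∙z≈y∙xz a₁ b₃ b₂ ⟩
  b₃ * (a₁ * b₂)  ≡⟨ cong (_*_ b₃) u∥v ⟩
  b₃ * (b₁ * a₂)  ≡⟨ *-Semigroup.x∙yz≈y∙zx b₃ b₁ a₂ ⟩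
  b₁ * (a₂ * b₃)  ≡⟨ cong (_*_ b₁) v∥w ⟩
  b₁ * (b₂ * a₃)  ≡⟨ *-Semigroup.xy∙z≈x∙zy b₁ a₃ b₂ ⟨
  b₁ * a₃ * b₂    ∎)
  where open ≡-Reasoning

∥-chain : (v : ℤ → ℤ²) → (∀ k → 0ℤ < proj₂ (v k)) → (∀ k → v k ∥ v (k + 1ℤ)) → ∀ k → v k ∥ v 0ℤ
∥-chain v pos step = ℤ-induction (λ k → v k ∥ v 0ℤ) (∥-refl {v 0ℤ})
  (λ k vk∥v0 → ∥-trans {v (k + 1ℤ)} {v k} {v 0ℤ} (pos k) (∥-sym {v k} {v (k + 1ℤ)} (step k)) vk∥v0)
  (λ k vk+1∥v0 → ∥-trans {v k} {v (k + 1ℤ)} {v 0ℤ} (pos (k + 1ℤ)) (step k) vk+1∥v0)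

adjacent-minors-∥ : ∀ a b c a′ b′ c′ → a′ * b - a * b′ ≡ 1ℤ → b′ * c - b * c′ ≡ 1ℤ →
                    (a + c , b) ∥ (a′ + c′ , b′)
adjacent-minors-∥ a b c a′ b′ c′ left right = begin
  (a + c) * b′
    ≡⟨ expand a b c a′ b′ c′ ⟩
  b * (a′ + c′) + ((b′ * c - b * c′) - (a′ * b - a * b′))
    ≡⟨ cong₂ (λ r l → b * (a′ + c′) + (r - l)) right left ⟩
  b * (a′ + c′) + (1ℤ - 1ℤ)
    ≡⟨ +-identityʳ _ ⟩
  b * (a′ + c′)
    ∎
  where
  open ≡-Reasoning
  expand : ∀ a b c a′ b′ c′ → (a + c) * b′ ≡ b * (a′ + c′) + ((b′ * c - b * c′) - (a′ * b - a * b′))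
  expand = solve-∀

Recurrence : (s t f : ℤ → ℤ) → Set
Recurrence s t f = ∀ j → (f j + f (j + 1ℤ + 1ℤ) , f (j + 1ℤ)) ∥ (t j , s j)

recurrence-unique : ∀ {s t f g} → (∀ j → 0ℤ < s j) → Recurrence s t f → Recurrence s t g →
                    f 0ℤ ≡ g 0ℤ → f 1ℤ ≡ g 1ℤ → ∀ j → f j ≡ g j
recurrence-unique {s} {t} {f} {g} s>0 rec-f rec-g f0≡g0 f1≡g1 j =
  proj₁ (ℤ-induction Agree (f0≡g0 , f1≡g1) up down j)
  where
  Agree : ℤ → Set
  Agree j = f j ≡ g j × f (j + 1ℤ) ≡ g (j + 1ℤ)
  sums-agree : ∀ j → f (j + 1ℤ) ≡ g (j + 1ℤ) → f j + f (j + 1ℤ + 1ℤ) ≡ g j + g (j + 1ℤ + 1ℤ)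
  sums-agree j e = cancel-pos-factor (s>0 j) refl (begin
    (f j + f (j + 1ℤ + 1ℤ)) * s j  ≡⟨ rec-f j ⟩
    f (j + 1ℤ) * t j               ≡⟨ cong (_* t j) e ⟩
    g (j + 1ℤ) * t j               ≡⟨ rec-g j ⟨
    (g j + g (j + 1ℤ + 1ℤ)) * s j  ∎)
    where open ≡-Reasoning
  up : ∀ j → Agree j → Agree (j + 1ℤ)
  up j (e₀ , e₁) =
    e₁ , ∙-cancelˡ (f j) _ _ (trans (sums-agree j e₁) (cong (_+ g (j + 1ℤ + 1ℤ)) (sym e₀)))
  down : ∀ j → Agree (j + 1ℤ) → Agree j
  down j (e₁ , e₂) =
    ∙-cancelʳ (f (j + 1ℤ + 1ℤ)) _ _ (trans (sums-agree j e₁) (cong (_+_ (g j)) (sym e₂))) , e₁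

recurrence-det : ∀ {s t} v (w : ℤ → ℤ²) → Recurrence s t (proj₁ ∘ w) → Recurrence s t (proj₂ ∘ w) →
                 Recurrence s t (det v ∘ w)
recurrence-det {s} {t} (v₁ , v₂) w rec₁ rec₂ j = begin
  (det (v₁ , v₂) (w j) + det (v₁ , v₂) (w j″)) * s j
    ≡⟨ collect v₁ v₂ (a j) (b j) (a j″) (b j″) (s j) ⟩
  v₁ * ((b j + b j″) * s j) - v₂ * ((a j + a j″) * s j)
    ≡⟨ cong₂ (λ x y → v₁ * x - v₂ * y) (rec₂ j) (rec₁ j) ⟩
  v₁ * (b j′ * t j) - v₂ * (a j′ * t j)
    ≡⟨ collect-t v₁ v₂ (a j′) (b j′) (t j) ⟩
  det (v₁ , v₂) (w j′) * t j ∎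
  where
  open ≡-Reasoning
  a b : ℤ → ℤ
  a = proj₁ ∘ w
  b = proj₂ ∘ w
  j′ j″ : ℤ
  j′ = j + 1ℤ
  j″ = j + 1ℤ + 1ℤ
  collect : ∀ v₁ v₂ a b a″ b″ s → ((v₁ * b - v₂ * a) + (v₁ * b″ - v₂ * a″)) * s
                                  ≡ v₁ * ((b + b″) * s) - v₂ * ((a + a″) * s)
  collect = solve-∀
  collect-t : ∀ v₁ v₂ a b t → v₁ * (b * t) - v₂ * (a * t) ≡ (v₁ * b - v₂ * a) * t
  collect-t = solve-∀

positive-diagonal : ∀ {x y a b c d} → 0ℤ < y → x * y ≡ a * b + c * d →
                    0ℤ ≤ a → 0ℤ ≤ b → 0ℤ < c → 0ℤ < d → 0ℤ < x
positive-diagonal {x} {y} {a} {b} {c} {d} y>0 ptolemy a≥0 b≥0 c>0 d>0 =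
  *-cancelʳ-<-nonNeg y {{nonNegative (<⇒≤ y>0)}} (subst (0ℤ <_) (sym ptolemy) sum>0)
  where
  sum>0 : 0ℤ < a * b + c * d
  sum>0 = +-mono-≤-< (*-monoʳ-≤-nonNeg b {{nonNegative b≥0}} a≥0) (*-monoʳ-<-pos d {{ℤ.positive d>0}} c>0)

ptolemy-rotate : ∀ {A : Set} (f : A → ℤ) ab bc cd da ac bd →
                 f bd * f ac ≡ f bc * f da + f cd * f ab → f ac * f bd ≡ f ab * f cd + f bc * f da
ptolemy-rotate f ab bc cd da ac bd rotated = begin
  f ac * f bd                ≡⟨ *-comm (f ac) (f bd) ⟩
  f bd * f ac                ≡⟨ rotated ⟩
  f bc * f da + f cd * f ab  ≡⟨ +-comm (f bc * f da) (f cd * f ab) ⟩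
  f cd * f ab + f bc * f da  ≡⟨ cong (_+ f bc * f da) (*-comm (f cd) (f ab)) ⟩
  f ab * f cd + f bc * f da  ∎
  where open ≡-Reasoning

module _ {m n : ℕ} {u : ℤ → ℤ → ℤ} (T : IsPosIntPeriodicSL2Tiling m n u) where

  open IsPosIntPeriodicSL2Tiling T

  row-recurrence : ∀ k → Recurrence (λ j → u 0ℤ (j + 1ℤ)) (λ j → u 0ℤ j + u 0ℤ (j + 1ℤ + 1ℤ)) (u k)
  row-recurrence k j = ∥-chain three-term (λ k → positive k (j + 1ℤ)) adjacent k
    where
    three-term : ℤ → ℤ²
    three-term k = u k j + u k (j + 1ℤ + 1ℤ) , u k (j + 1ℤ)
    adjacent : ∀ k → three-term k ∥ three-term (k + 1ℤ)
    adjacent k = adjacent-minors-∥ (u k j) (u k (j + 1ℤ)) (u k (j + 1ℤ + 1ℤ))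
                   (u (k + 1ℤ) j) (u (k + 1ℤ) (j + 1ℤ)) (u (k + 1ℤ) (j + 1ℤ + 1ℤ))
                   (sl2 k j) (sl2 k (j + 1ℤ))

  w : ℤ → ℤ²
  w j = u 0ℤ j , u 1ℤ j

  det-w-succ : ∀ j → det (w (j + 1ℤ)) (w j) ≡ 1ℤ
  det-w-succ j = trans (commute (u 0ℤ (j + 1ℤ)) (u 1ℤ j) (u 1ℤ (j + 1ℤ)) (u 0ℤ j)) (sl2 0ℤ j)
    where
    commute : ∀ a b c d → a * b - c * d ≡ b * a - d * c
    commute = solve-∀

  x : ℤ → ℤ²
  x i = cramer (w 0ℤ) (w 1ℤ) (u i 0ℤ) (u i 1ℤ)

  det-x-w : ∀ i j → det (x i) (w j) ≡ u i j
  det-x-w i = recurrence-unique (λ j → positive 0ℤ (j + 1ℤ))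
    (recurrence-det (x i) w (row-recurrence 0ℤ) (row-recurrence 1ℤ)) (row-recurrence i)
    (cramer-det₀ (w 0ℤ) (w 1ℤ) (u i 0ℤ) (u i 1ℤ) (det-w-succ 0ℤ))
    (cramer-det₁ (w 0ℤ) (w 1ℤ) (u i 0ℤ) (u i 1ℤ) (det-w-succ 0ℤ))

  minor : ℤ → ℤ → ℤ → ℤ → ℤ
  minor a a′ b b′ = u a b * u a′ b′ - u a b′ * u a′ b

  det-x-x : ∀ a a′ j → det (x a) (x a′) ≡ minor a a′ (j + 1ℤ) j
  det-x-x a a′ j = trans (det-in-unimodular-basis (x a) (x a′) (w (j + 1ℤ)) (w j) (det-w-succ j))
    (cong₂ _-_ (cong₂ _*_ (det-x-w a (j + 1ℤ)) (det-x-w a′ j))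
               (cong₂ _*_ (det-x-w a j) (det-x-w a′ (j + 1ℤ))))

  det-x-succ : ∀ i → det (x i) (x (i + 1ℤ)) ≡ 1ℤ
  det-x-succ i = trans (det-x-x i (i + 1ℤ) 0ℤ)
    (trans (cong (_- u i 0ℤ * u (i + 1ℤ) 1ℤ) (*-comm (u i 1ℤ) (u (i + 1ℤ) 0ℤ))) (sl2 i 0ℤ))

  det-w-w : ∀ i b b′ → det (w b) (w b′) ≡ minor i (i + 1ℤ) b b′
  det-w-w i b b′ = begin
    det (w b) (w b′)
      ≡⟨ det-in-unimodular-basis (w b) (w b′) (x i) (x (i + 1ℤ)) (det-x-succ i) ⟩
    det (w b) (x i) * det (w b′) (x (i + 1ℤ)) - det (w b) (x (i + 1ℤ)) * det (w b′) (x i)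
      ≡⟨ cong₂ _-_ (cong₂ _*_ (det-w-x i b) (det-w-x (i + 1ℤ) b′))
                   (cong₂ _*_ (det-w-x (i + 1ℤ) b) (det-w-x i b′)) ⟩
    (- u i b) * (- u (i + 1ℤ) b′) - (- u (i + 1ℤ) b) * (- u i b′)
      ≡⟨ signs (u i b) (u (i + 1ℤ) b′) (u (i + 1ℤ) b) (u i b′) ⟩
    minor i (i + 1ℤ) b b′ ∎
    where
    open ≡-Reasoning
    det-w-x : ∀ a b → det (w b) (x a) ≡ - u a b
    det-w-x a b = trans (det-antisym (w b) (x a)) (cong -_ (det-x-w a b))
    signs : ∀ a b c d → (- a) * (- b) - (- c) * (- d) ≡ a * b - d * c
    signs = solve-∀

  periodic-iterate : ∀ k i j → u (i + k * + m) (j + k * + n) ≡ u i j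
  periodic-iterate = ℤ-induction (λ k → ∀ i j → u (i + k * + m) (j + k * + n) ≡ u i j)
    (λ i j → cong₂ u (+-identityʳ i) (+-identityʳ j))
    (λ k iterate i j → trans (cong₂ u (step i k (+ m)) (step j k (+ n)))
                             (trans (periodic (i + k * + m) (j + k * + n)) (iterate i j)))
    (λ k iterate i j → trans (sym (periodic (i + k * + m) (j + k * + n)))
                             (trans (cong₂ u (sym (step i k (+ m))) (sym (step j k (+ n)))) (iterate i j)))
    where
    step : ∀ i k M → i + (k + 1ℤ) * M ≡ (i + k * M) + M
    step = solve-∀

  minor-periodic : ∀ k a a′ b b′ →
                   minor (a + k * + m) (a′ + k * + m) (b + k * + n) (b′ + k * + n) ≡ minor a a′ b b′
  minor-periodic k a a′ b b′ =
    cong₂ _-_ (cong₂ _*_ (periodic-iterate k a b) (periodic-iterate k a′ b′))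
              (cong₂ _*_ (periodic-iterate k a b′) (periodic-iterate k a′ b))

  vec : Pt → ℤ²
  vec (p i) = x i
  vec (q j) = w j

  δ : Pt × Pt → ℤ
  δ (s , t) = det (vec s) (vec t)

  δ-shift : ∀ k {s t} → s ≺ t → δ (shiftPt {m} {n} k s , shiftPt {m} {n} k t) ≡ δ (s , t)
  δ-shift k {p a} {p a′} _ = begin
    det (x (a + k * + m)) (x (a′ + k * + m))
      ≡⟨ det-x-x (a + k * + m) (a′ + k * + m) (k * + n) ⟩
    minor (a + k * + m) (a′ + k * + m) (k * + n + 1ℤ) (k * + n)
      ≡⟨ cong₂ (minor (a + k * + m) (a′ + k * + m)) (+-comm 1ℤ (k * + n)) (+-identityˡ (k * + n)) ⟨
    minor (a + k * + m) (a′ + k * + m) (1ℤ + k * + n) (0ℤ + k * + n)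
      ≡⟨ minor-periodic k a a′ 1ℤ 0ℤ ⟩
    minor a a′ 1ℤ 0ℤ
      ≡⟨ det-x-x a a′ 0ℤ ⟨
    det (x a) (x a′) ∎
    where open ≡-Reasoning
  δ-shift k {p a} {q b} _ = trans (det-x-w _ _) (trans (periodic-iterate k a b) (sym (det-x-w a b)))
  δ-shift k {q b} {q b′} _ = begin
    det (w (b + k * + n)) (w (b′ + k * + n))
      ≡⟨ det-w-w (k * + m) (b + k * + n) (b′ + k * + n) ⟩
    minor (k * + m) (k * + m + 1ℤ) (b + k * + n) (b′ + k * + n)
      ≡⟨ cong₂ (λ a a′ → minor a a′ (b + k * + n) (b′ + k * + n))
               (+-identityˡ (k * + m)) (+-comm 1ℤ (k * + m)) ⟨
    minor (0ℤ + k * + m) (1ℤ + k * + m) (b + k * + n) (b′ + k * + n)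
      ≡⟨ minor-periodic k 0ℤ 1ℤ b b′ ⟩
    minor 0ℤ 1ℤ b b′
      ≡⟨ det-w-w 0ℤ b b′ ⟨
    det (w b) (w b′) ∎
    where open ≡-Reasoning

  det-x-w-pos : ∀ i j → 0ℤ < det (x i) (w j)
  det-x-w-pos i j = subst (0ℤ <_) (sym (det-x-w i j)) (positive i j)

  det-x-x-pos : ∀ i t → 0ℤ < det (x i) (x (i + + suc t))
  det-x-x-pos i zero    = subst (0ℤ <_) (sym (det-x-succ i)) (+<+ (s≤s z≤n))
  det-x-x-pos i (suc t) = subst (λ c → 0ℤ < det (x i) (x c)) (i+[1+t]+1≡i+[2+t] i t)
    (positive-diagonal (det-x-w-pos c 0ℤ) (det-plücker (x i) (x c) (x (c + 1ℤ)) (w 0ℤ))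
      (<⇒≤ (det-x-x-pos i t)) (<⇒≤ (det-x-w-pos (c + 1ℤ) 0ℤ))
      (subst (0ℤ <_) (sym (det-x-succ c)) (+<+ (s≤s z≤n))) (det-x-w-pos i 0ℤ))
    where
    c : ℤ
    c = i + + suc t

  det-w-w-pos : ∀ j t → 0ℤ < det (w (j + + suc t)) (w j)
  det-w-w-pos j zero    = subst (0ℤ <_) (sym (det-w-succ j)) (+<+ (s≤s z≤n))
  det-w-w-pos j (suc t) = subst (λ c → 0ℤ < det (w c) (w j)) (i+[1+t]+1≡i+[2+t] j t)
    (positive-diagonal (det-x-w-pos 0ℤ c)
      (trans (*-comm (det (w (c + 1ℤ)) (w j)) (det (x 0ℤ) (w c)))
             (det-plücker (x 0ℤ) (w (c + 1ℤ)) (w c) (w j)))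
      (<⇒≤ (det-x-w-pos 0ℤ (c + 1ℤ))) (<⇒≤ (det-w-w-pos j t))
      (subst (0ℤ <_) (sym (det-w-succ c)) (+<+ (s≤s z≤n))) (det-x-w-pos 0ℤ j))
    where
    c : ℤ
    c = j + + suc t

  Fᵤ : LArc m n → ℤ
  Fᵤ a = δ (ends a)

  Fᵤ-invariant : ∀ k a → Fᵤ (shift k a) ≡ Fᵤ a
  Fᵤ-invariant k a = trans (cong δ (ends-shift k a)) (δ-shift k (ends-ordered a))

  Fᵤ-boundary : ∀ a → IsBoundary a → Fᵤ a ≡ 1ℤ
  Fᵤ-boundary (pp i fzero) _ = det-x-succ i
  Fᵤ-boundary (qq j fzero) _ = det-w-succ j

  Fᵤ-positive : ∀ a → 0ℤ < Fᵤ a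
  Fᵤ-positive (br i j) = det-x-w-pos i j
  Fᵤ-positive (pp i d) = det-x-x-pos i (toℕ d)
  Fᵤ-positive (qq j d) = det-w-w-pos j (toℕ d)

  Fᵤ-joins : ∀ a {X Y} → Joins a X Y → X ≺ Y → Fᵤ a ≡ δ (X , Y)
  Fᵤ-joins a (inj₁ ends≡XY) _   = cong δ ends≡XY
  Fᵤ-joins a (inj₂ ends≡YX) X≺Y =
    ⊥-elim (≺-asym X≺Y (subst (λ e → proj₁ e ≺ proj₂ e) ends≡YX (ends-ordered a)))

  Fᵤ-ptolemy-sorted : ∀ {A B C D} ab bc cd da ac bd → A ≺ B → B ≺ C → C ≺ D →
                      Joins ab A B → Joins bc B C → Joins cd C D → Joins da D A →
                      Joins ac A C → Joins bd B D →
                      Fᵤ ac * Fᵤ bd ≡ Fᵤ ab * Fᵤ cd + Fᵤ bc * Fᵤ da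
  Fᵤ-ptolemy-sorted {A} {B} {C} {D} ab bc cd da ac bd A≺B B≺C C≺D jab jbc jcd jda jac jbd = begin
    Fᵤ ac * Fᵤ bd
      ≡⟨ cong₂ _*_ (Fᵤ-joins ac jac A≺C) (Fᵤ-joins bd jbd B≺D) ⟩
    δ (A , C) * δ (B , D)
      ≡⟨ det-plücker (vec A) (vec B) (vec C) (vec D) ⟩
    δ (A , B) * δ (C , D) + δ (B , C) * δ (A , D)
      ≡⟨ cong₂ _+_ (cong₂ _*_ (Fᵤ-joins ab jab A≺B) (Fᵤ-joins cd jcd C≺D))
                   (cong₂ _*_ (Fᵤ-joins bc jbc B≺C) (Fᵤ-joins da (swap jda) (≺-trans A≺B B≺D))) ⟨
    Fᵤ ab * Fᵤ cd + Fᵤ bc * Fᵤ da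
      ∎
    where
    open ≡-Reasoning
    A≺C : A ≺ C
    A≺C = ≺-trans A≺B B≺C
    B≺D : B ≺ D
    B≺D = ≺-trans B≺C C≺D

  -- The vertices of a quadrilateral are sorted along the boundary of the strip up to a cyclic
  -- rotation, and the Ptolemy relation is invariant under rotating the quadrilateral.
  Fᵤ-ptolemy : ∀ A B C D (ab bc cd da ac bd : LArc m n) → Quadrilateral A B C D ab bc cd da →
               Joins ac A C → Joins bd B D → Fᵤ ac * Fᵤ bd ≡ Fᵤ ab * Fᵤ cd + Fᵤ bc * Fᵤ da
  Fᵤ-ptolemy A B C D ab bc cd da ac bd Q jac jbd = by-rotation (Quadrilateral.cyc Q)
    where
    open Quadrilateral Q using () renaming (j-ab to jab; j-bc to jbc; j-cd to jcd; j-da to jda)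
    by-rotation : CycOrder A B C D → Fᵤ ac * Fᵤ bd ≡ Fᵤ ab * Fᵤ cd + Fᵤ bc * Fᵤ da
    by-rotation (inj₁ (A≺B , B≺C , C≺D)) =
      Fᵤ-ptolemy-sorted ab bc cd da ac bd A≺B B≺C C≺D jab jbc jcd jda jac jbd
    by-rotation (inj₂ (inj₁ (B≺C , C≺D , D≺A))) =
      ptolemy-rotate Fᵤ ab bc cd da ac bd
        (Fᵤ-ptolemy-sorted bc cd da ab bd ac B≺C C≺D D≺A jbc jcd jda jab jbd (swap jac))
    by-rotation (inj₂ (inj₂ (inj₁ (C≺D , D≺A , A≺B)))) =
      ptolemy-rotate Fᵤ ab bc cd da ac bd (ptolemy-rotate Fᵤ bc cd da ab bd ac
        (Fᵤ-ptolemy-sorted cd da ab bc ac bd C≺D D≺A A≺B jcd jda jab jbc (swap jac) (swap jbd)))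
    by-rotation (inj₂ (inj₂ (inj₂ (D≺A , A≺B , B≺C)))) =
      ptolemy-rotate Fᵤ ab bc cd da ac bd (ptolemy-rotate Fᵤ bc cd da ab bd ac
        (ptolemy-rotate Fᵤ cd da ab bc ac bd
          (Fᵤ-ptolemy-sorted da ab bc cd bd ac D≺A A≺B B≺C jda jab jbc jcd (swap jbd) jac)))

  tiling⇒frieze : Σ (LArc m n → ℤ) λ F → IsPosIntFrieze m n F × (∀ i j → Φ F i j ≡ u i j)
  tiling⇒frieze = Fᵤ , isFrieze , det-x-w
    where
    isFrieze : IsPosIntFrieze m n Fᵤ
    isFrieze = record
      { invariant = Fᵤ-invariant
      ; positive  = Fᵤ-positive
      ; boundary  = Fᵤ-boundary
      ; ptolemy   = Fᵤ-ptolemy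
      }

theorem5p6 : (m n : ℕ) → 1 ℕ.≤ m → 1 ℕ.≤ n →
    -- the map is well defined
    ((F : LArc m n → ℤ) → IsPosIntFrieze m n F →
       IsPosIntPeriodicSL2Tiling m n (Φ F))
    -- injective (functions on arcs compared pointwise)
    × ((F G : LArc m n → ℤ) → IsPosIntFrieze m n F → IsPosIntFrieze m n G →
       (∀ i j → Φ F i j ≡ Φ G i j) → ∀ a → F a ≡ G a)
    -- surjective
    × ((u : ℤ → ℤ → ℤ) → IsPosIntPeriodicSL2Tiling m n u →
       Σ (LArc m n → ℤ) λ F → IsPosIntFrieze m n F × (∀ i j → Φ F i j ≡ u i j))
theorem5p6 (suc m) (suc n) _ _ =
  (λ _ → frieze⇒tiling) , (λ _ _ → frieze-determined) , (λ _ → tiling⇒frieze)
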